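{- Let $G=(V,E)$ be a connected graph with a fixed spanning tree $T$, let $\alpha,\beta$ be two proper 3-colourings of $G$ and let $u^*$ be a focal vertex of $\beta$. For any $(\alpha\to\beta)$-recolouring $R$ of length $\ell$, we have $\ell\ge\frac12\min\{J(k_1),J(k_2)\}$.
   Context: A proper 3-colouring is a map $c:V\to\{1,2,3\}$ with $c(x)\ne c(y)$ for all $xy\in E$. A $(c_0\to c_\ell)$-recolouring of length $\ell$ is a sequence $c_0,\dots,c_\ell$ of proper 3-colourings in which consecutive colourings disagree on at most one vertex. $R_3(G)$ is the graph on proper 3-colourings, adjacent iff they differ on exactly one vertex. A vertex $v$ is fixed with respect to $c$ if every proper 3-colouring in the same component of $R_3(G)$ as $c$ gives $v$ colour $c(v)$. For an edge oriented from $x$ to $y$, $w(c,\overrightarrow{xy})\in\{ -1,1\}$ satisfies $w(c,\overrightarrow{xy})\equiv c(y)-c(x)\pmod 3$; path weights are sums of edge weights; $\overrightarrow{P_{uv}}$ is the $u$–$v$ path in $T$ oriented from $u$ to $v$; $h_{\alpha,u}(c,v)=w(c,\overrightarrow{P_{uv}})-w(\alpha,\overrightarrow{P_{uv}})$. A focal vertex $u^*$ of $\beta$ is: an arbitrary fixed vertex with respect to $\beta$ if one exists; otherwise a vertex that is a median when vertices are ordered by $h_{\alpha,u}(\beta,v)$ for some vertex $u$ (the order is independent of $u$), i.e. at least $|V|/2$ vertices $v$ have $h_{\alpha,u}(\beta,v)\le h_{\alpha,u}(\beta,u^*)$ and at least $|V|/2$ have $h_{\alpha,u}(\beta,v)\ge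 h_{\alpha,u}(\beta,u^*)$. $J(k)=\sum_{v\in V}|k+h_{\alpha,u^*}(\beta,v)|$. $k_1$ (resp. $k_2$) is the smallest non-negative (resp. largest non-positive) integer congruent to $2(\alpha(u^*)-\beta(u^*))$ modulo 6. -}

module Defs where

open import Data.Nat as ℕ using (ℕ; zero; suc; _<_; _≤_; _%_)
open import Data.Nat.Properties using (_≟_)
open import Data.Integer as ℤ using (ℤ; +_; ∣_∣)
open import Data.Integer.DivMod using (_%ℕ_)
open import Data.Integer.Properties using () renaming (_≤?_ to _≤ℤ?_)
open import Data.Fin using (Fin; toℕ)
open import Data.List using (List; []; _∷_; length; filter; map)
open import Data.Nat.ListAction using (sum)
open import Data.List.Relation.Unary.Unique.Propositional using (Unique)
open import Data.Fin.Base using ()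
open import Data.List using (allFin) public
open import Data.Product using (Σ; ∃; _×_; _,_)
open import Data.Sum using (_⊎_)
open import Relation.Nullary using (¬_; yes; no)
open import Relation.Binary.PropositionalEquality using (_≡_; _≢_)

record Graph (n : ℕ) : Set₁ where
  field
    E      : Fin n → Fin n → Set
    sym    : ∀ {x y} → E x y → E y x
    irrefl : ∀ {x} → ¬ E x x
open Graph public

data Walk {n : ℕ} (R : Fin n → Fin n → Set) : Fin n → Fin n → Set where
  []   : ∀ {u} → Walk R u u
  step : ∀ {u w v} → R u w → Walk R w v → Walk R u v

vertices : ∀ {n} {R : Fin n → Fin n → Set} {u v} → Walk R u v → List (Fin n)
vertices {u = u} []           = u ∷ []
vertices {u = u} (step _ p)   = u ∷ vertices p

IsPath : ∀ {n} {R : Fin n → Fin n → Set} {u v} → Walk R u v → Set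
IsPath p = Unique (vertices p)

Connected : ∀ {n} → Graph n → Set
Connected G = ∀ u v → Walk (E G) u v

-- A spanning tree T of G: a subgraph on all vertices, connected (with a
-- chosen u–v path P u v for all u v) and acyclic (u–v paths are unique).
record SpanningTree {n : ℕ} (G : Graph n) : Set₁ where
  field
    TE       : Fin n → Fin n → Set
    TE-sub   : ∀ {x y} → TE x y → E G x y
    TE-sym   : ∀ {x y} → TE x y → TE y x
    P        : ∀ u v → Walk TE u v
    P-isPath : ∀ u v → IsPath (P u v)
    unique   : ∀ u v (p q : Walk TE u v) → IsPath p → IsPath q →
               vertices p ≡ vertices q
open SpanningTree public

Colouring : ℕ → Set
Colouring n = Fin n → Fin 3

Proper : ∀ {n} → Graph n → Colouring n → Set
Proper G c = ∀ x y → E G x y → c x ≢ c y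

AtMostOneDiff : ∀ {n} → Colouring n → Colouring n → Set
AtMostOneDiff {n} c d = ∃ λ (v : Fin n) → ∀ x → x ≢ v → c x ≡ d x

record Recolouring {n : ℕ} (G : Graph n) (α β : Colouring n) (ℓ : ℕ) : Set where
  field
    seq    : ℕ → Colouring n
    start  : ∀ x → seq 0 x ≡ α x
    end    : ∀ x → seq ℓ x ≡ β x
    proper : ∀ i → i ≤ ℓ → Proper G (seq i)
    steps  : ∀ i → i < ℓ → AtMostOneDiff (seq i) (seq (suc i))

SameComponent : ∀ {n} → Graph n → Colouring n → Colouring n → Set
SameComponent G c d = ∃ λ ℓ → Recolouring G c d ℓ

Fixed : ∀ {n} → Graph n → Colouring n → Fin n → Set
Fixed G c v = ∀ d → Proper G d → SameComponent G c d → d v ≡ c v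

-- w(c, x→y) ∈ {-1,1} with w ≡ c(y) - c(x) (mod 3); (0 if c x = c y,
-- which never happens for edges of a proper colouring)
w : ∀ {n} → Colouring n → Fin n → Fin n → ℤ
w c x y with (toℕ (c y) ℕ.+ 3 ℕ.∸ toℕ (c x)) % 3
... | 1 = + 1
... | 2 = ℤ.- (+ 1)
... | _ = + 0

walkWeight : ∀ {n} {R : Fin n → Fin n → Set} {u v} → Colouring n → Walk R u v → ℤ
walkWeight c [] = + 0
walkWeight c (step {u} {x} _ p) = w c u x ℤ.+ walkWeight c p

module _ {n : ℕ} {G : Graph n} (T : SpanningTree G) (α : Colouring n) where

  h : Fin n → Colouring n → Fin n → ℤ
  h u c v = walkWeight c (P T u v) ℤ.- walkWeight α (P T u v)

  countLeq : Fin n → Colouring n → ℤ → ℕ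
  countLeq u c z = length (filter (λ v → h u c v ≤ℤ? z) (allFin n))

  countGeq : Fin n → Colouring n → ℤ → ℕ
  countGeq u c z = length (filter (λ v → z ≤ℤ? h u c v) (allFin n))

  Median : Colouring n → Fin n → Set
  Median β u* = ∃ λ u →
    (n ℕ.≤ 2 ℕ.* countLeq u β (h u β u*)) ×
    (n ℕ.≤ 2 ℕ.* countGeq u β (h u β u*))

  Focal : Colouring n → Fin n → Set
  Focal β u* = Fixed G β u* ⊎ ((∀ v → ¬ Fixed G β v) × Median β u*)

  J : Colouring n → Fin n → ℤ → ℕ
  J β u* k = sum (map (λ v → ∣ k ℤ.+ h u* β v ∣) (allFin n))

k₁ : ∀ {n} → Colouring n → Colouring n → Fin n → ℤ
k₁ α β u* = + ((+ 2 ℤ.* (+ toℕ (α u*) ℤ.- + toℕ (β u*))) %ℕ 6)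

-- k₂: largest non-positive integer ≡ 2(α(u*) - β(u*)) (mod 6)
k₂ : ∀ {n} → Colouring n → Colouring n → Fin n → ℤ
k₂ α β u* with (+ 2 ℤ.* (+ toℕ (α u*) ℤ.- + toℕ (β u*))) %ℕ 6
... | zero  = + 0
... | suc r = + suc r ℤ.- + 6

-- Along each tree edge a proper 3-colouring takes a step of ±1, so it is the gradient of an
-- integer height function. Recolouring a vertex from a to b moves its height by the
-- representative of b − a (mod 3) in {−2, 0, 2} and changes no other height: the recoloured
-- vertex differs from all its neighbours both before and after, so every edge weight changes
-- exactly by the difference of the height moves at its ends. Summing the moves along R gives a
-- displacement d with Σ_v |d(v)| ≤ 2ℓ and h_{α,u}(β,v) = d(v) − d(u), hence
-- J(d(u*)) = Σ_v |d(v)| ≤ 2ℓ. Each move from a to b is ≡ 2(a − b) (mod 6), so d(u*) lies in the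
-- residue class of k₁ and k₂, i.e. d(u*) ≥ k₁ ≥ 0 or d(u*) ≤ k₂ ≤ 0. J(k) is the total distance
-- from −k to the values h_{α,u*}(β,v); as u* is a median, at least half of these values are ≥ 0
-- and at least half are ≤ 0, so J is nondecreasing on k ≥ 0 and nonincreasing on k ≤ 0, giving
-- min(J(k₁), J(k₂)) ≤ J(d(u*)). A fixed u* is never recoloured, so then d(u*) = 0 = k₁.

module Submission where

open import Defs
open import Data.Nat using (ℕ; _≤_; _*_; _⊓_)
open import Data.Fin using (Fin)

open import Data.Nat as ℕ using (zero; suc; z≤n; _∸_; _≤′_; ≤′-refl; ≤′-step)
import Data.Nat.Properties as ℕ
open import Data.Nat.ListAction using (sum)
import Data.Nat.Tactic.RingSolver as ℕ-Solver
open import Data.Integer as ℤ using (ℤ; +_; -[1+_]; 0ℤ; ∣_∣; -_; +≤+; -≤+; -≤-)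
import Data.Integer.Properties as ℤ
open import Data.Integer.Divisibility.Signed using (_∣_; _∣?_; divides; ∣m∣n⇒∣m+n)
open import Data.Integer.DivMod using (_%ℕ_; _/ℕ_; n%ℕd<d; a≡a%ℕn+[a/ℕn]*n)
import Data.Integer.Tactic.RingSolver as ℤ-Solver
open import Data.Fin using (toℕ; suc) renaming (_≟_ to _≟ᶠ_)
open import Data.Fin.Patterns using (0F; 1F; 2F)
open import Data.Fin.Properties using (all?; suc-injective)
open import Data.List using (List; []; _∷_; map; length; filter)
import Data.List.Properties as List
open import Data.Sum using (_⊎_; inj₁; inj₂)
open import Data.Product using (_,_)
open import Function using (_∘_)
import Algebra.Properties.CommutativeSemigroup as CommutativeSemigroupProperties
open import Relation.Nullary using (¬?; yes; no)
open import Relation.Nullary.Decidable using (from-yes; _→-dec_; _⊎-dec_)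
open import Relation.Unary using (Decidable)
open import Relation.Binary.PropositionalEquality
  using (_≡_; _≢_; refl; trans; cong; cong₂; subst; subst₂; module ≡-Reasoning)
import Relation.Binary.PropositionalEquality as ≡

module ℕ+ = CommutativeSemigroupProperties ℕ.+-commutativeSemigroup
module ℤ+ = CommutativeSemigroupProperties ℤ.+-commutativeSemigroup

w₃ : Fin 3 → Fin 3 → ℤ
w₃ 0F 0F = 0ℤ
w₃ 0F 1F = + 1
w₃ 0F 2F = - + 1
w₃ 1F 0F = - + 1
w₃ 1F 1F = 0ℤ
w₃ 1F 2F = + 1
w₃ 2F 0F = + 1
w₃ 2F 1F = - + 1
w₃ 2F 2F = 0ℤ

w≡w₃ : ∀ {n} (c : Colouring n) x y → w c x y ≡ w₃ (c x) (c y)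
w≡w₃ c x y with c x | c y
... | 0F | 0F = refl
... | 0F | 1F = refl
... | 0F | 2F = refl
... | 1F | 0F = refl
... | 1F | 1F = refl
... | 1F | 2F = refl
... | 2F | 0F = refl
... | 2F | 1F = refl
... | 2F | 2F = refl

-- The height move of a vertex recoloured from a to b.
shift : Fin 3 → Fin 3 → ℤ
shift a b = - (+ 2 ℤ.* w₃ a b)

-- k₁ α β u unfolds to + (twiceDiff (α u) (β u) %ℕ 6).
twiceDiff : Fin 3 → Fin 3 → ℤ
twiceDiff a b = + 2 ℤ.* (+ toℕ a ℤ.- + toℕ b)

w₃-recolour : ∀ a b a′ b′ → a ≢ b → a′ ≢ b′ → a ≡ a′ ⊎ b ≡ b′ →
              w₃ a′ b′ ℤ.+ shift a a′ ≡ w₃ a b ℤ.+ shift b b′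
w₃-recolour = from-yes (all? λ a → all? λ b → all? λ a′ → all? λ b′ →
  ¬? (a ≟ᶠ b) →-dec ¬? (a′ ≟ᶠ b′) →-dec (a ≟ᶠ a′ ⊎-dec b ≟ᶠ b′) →-dec
  w₃ a′ b′ ℤ.+ shift a a′ ℤ.≟ w₃ a b ℤ.+ shift b b′)

shift-refl : ∀ a → shift a a ≡ 0ℤ
shift-refl = from-yes (all? λ a → shift a a ℤ.≟ 0ℤ)

∣shift∣≤2 : ∀ a b → ∣ shift a b ∣ ≤ 2
∣shift∣≤2 = from-yes (all? λ a → all? λ b → ∣ shift a b ∣ ℕ.≤? 2)

shift≡twiceDiff-mod-6 : ∀ a b → + 6 ∣ shift a b ℤ.- twiceDiff a b
shift≡twiceDiff-mod-6 = from-yes (all? λ a → all? λ b → + 6 ∣? shift a b ℤ.- twiceDiff a b)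

twiceDiff-refl : ∀ a → twiceDiff a a ≡ 0ℤ
twiceDiff-refl = from-yes (all? λ a → twiceDiff a a ℤ.≟ 0ℤ)

∣-twiceDiff-trans : ∀ {d e} a b c → + 6 ∣ d ℤ.- twiceDiff a b → + 6 ∣ e ℤ.- twiceDiff b c →
                    + 6 ∣ (d ℤ.+ e) ℤ.- twiceDiff a c
∣-twiceDiff-trans {d} {e} a b c 6∣d-ab 6∣e-bc =
  subst (+ 6 ∣_) (≡.sym (split d e (+ toℕ a) (+ toℕ b) (+ toℕ c))) (∣m∣n⇒∣m+n 6∣d-ab 6∣e-bc)
  where
  open ℤ-Solver
  split : ∀ d e a b c → (d ℤ.+ e) ℤ.- + 2 ℤ.* (a ℤ.- c) ≡
                        (d ℤ.- + 2 ℤ.* (a ℤ.- b)) ℤ.+ (e ℤ.- + 2 ℤ.* (b ℤ.- c))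
  split = solve-∀

∑ : ∀ m → (Fin m → ℕ) → ℕ
∑ m f = sum (map f (allFin m))

∑-suc : ∀ {m} (f : Fin (suc m) → ℕ) → ∑ (suc m) f ≡ f 0F ℕ.+ ∑ m (f ∘ suc)
∑-suc f = cong (λ xs → f 0F ℕ.+ sum xs)
  (trans (List.map-tabulate suc f) (≡.sym (List.map-tabulate (λ x → x) (f ∘ suc))))

∑-zero : ∀ m → ∑ m (λ _ → 0) ≡ 0
∑-zero zero    = refl
∑-zero (suc m) = trans (∑-suc {m} (λ _ → 0)) (∑-zero m)

∑-mono-≤ : ∀ {m} {f g : Fin m → ℕ} → (∀ x → f x ≤ g x) → ∑ m f ≤ ∑ m g
∑-mono-≤ {zero}  f≤g = z≤n
∑-mono-≤ {suc m} {f} {g} f≤g = begin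
  ∑ (suc m) f              ≡⟨ ∑-suc f ⟩
  f 0F ℕ.+ ∑ m (f ∘ suc)   ≤⟨ ℕ.+-mono-≤ (f≤g 0F) (∑-mono-≤ (f≤g ∘ suc)) ⟩
  g 0F ℕ.+ ∑ m (g ∘ suc)   ≡⟨ ∑-suc g ⟨
  ∑ (suc m) g              ∎
  where open ℕ.≤-Reasoning

∑-≤-except : ∀ {m} {f g : Fin m → ℕ} v {k} → (∀ x → x ≢ v → f x ≤ g x) → f v ≤ g v ℕ.+ k →
             ∑ m f ≤ ∑ m g ℕ.+ k
∑-≤-except {suc m} {f} {g} 0F {k} f≤g fv≤gv+k = begin
  ∑ (suc m) f                     ≡⟨ ∑-suc f ⟩
  f 0F ℕ.+ ∑ m (f ∘ suc)          ≤⟨ ℕ.+-mono-≤ fv≤gv+k (∑-mono-≤ (λ x → f≤g (suc x) λ ())) ⟩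
  g 0F ℕ.+ k ℕ.+ ∑ m (g ∘ suc)    ≡⟨ ℕ+.xy∙z≈xz∙y (g 0F) k _ ⟩
  g 0F ℕ.+ ∑ m (g ∘ suc) ℕ.+ k    ≡⟨ cong (ℕ._+ k) (∑-suc g) ⟨
  ∑ (suc m) g ℕ.+ k               ∎
  where open ℕ.≤-Reasoning
∑-≤-except {suc m} {f} {g} (suc v) {k} f≤g fv≤gv+k = begin
  ∑ (suc m) f                     ≡⟨ ∑-suc f ⟩
  f 0F ℕ.+ ∑ m (f ∘ suc)          ≤⟨ ℕ.+-mono-≤ (f≤g 0F λ ()) tail≤ ⟩
  g 0F ℕ.+ (∑ m (g ∘ suc) ℕ.+ k)  ≡⟨ ℕ.+-assoc (g 0F) _ k ⟨
  g 0F ℕ.+ ∑ m (g ∘ suc) ℕ.+ k    ≡⟨ cong (ℕ._+ k) (∑-suc g) ⟨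
  ∑ (suc m) g ℕ.+ k               ∎
  where
  open ℕ.≤-Reasoning
  tail≤ : ∑ m (f ∘ suc) ≤ ∑ m (g ∘ suc) ℕ.+ k
  tail≤ = ∑-≤-except v (λ x x≢v → f≤g (suc x) (x≢v ∘ suc-injective)) fv≤gv+k

MonotoneOnNonneg : (ℤ → ℕ) → Set
MonotoneOnNonneg F = ∀ {a b} → 0ℤ ℤ.≤ a → a ℤ.≤ b → F a ≤ F b

AntitoneOnNonpos : (ℤ → ℕ) → Set
AntitoneOnNonpos F = ∀ {a b} → a ℤ.≤ b → b ℤ.≤ 0ℤ → F b ≤ F a

-- The total distance from −k to the points f x; J T α β u* is distSum (h T α u* β) (allFin n).
distSum : ∀ {A : Set} → (A → ℤ) → List A → ℤ → ℕ
distSum f xs k = sum (map (λ x → ∣ k ℤ.+ f x ∣) xs)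

+-mono-≤-interchange : ∀ {a b c S S′ T N} → c ℕ.+ a ≤ b ℕ.+ 1 → S ℕ.+ T ≤ S′ ℕ.+ N →
                       (a ℕ.+ S) ℕ.+ (c ℕ.+ T) ≤ (b ℕ.+ S′) ℕ.+ suc N
+-mono-≤-interchange {a} {b} {c} {S} {S′} {T} {N} hd tl =
  subst₂ _≤_ (left a c S T) (right b S′ N) (ℕ.+-mono-≤ hd tl)
  where
  open ℕ-Solver
  left : ∀ a c S T → (c ℕ.+ a) ℕ.+ (S ℕ.+ T) ≡ (a ℕ.+ S) ℕ.+ (c ℕ.+ T)
  left = solve-∀
  right : ∀ b S′ N → (b ℕ.+ 1) ℕ.+ (S′ ℕ.+ N) ≡ (b ℕ.+ S′) ℕ.+ suc N
  right = solve-∀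

module _ {A : Set} (f : A → ℤ) {P : A → Set} (P? : Decidable P) where

  -- Moving −k one step away from the points f x ≥ 0 gains 1 on each of them and loses at
  -- most 1 on each other point.
  distSum-suc : (∀ x → P x → 0ℤ ℤ.≤ f x) → ∀ j xs →
                distSum f xs (+ j) ℕ.+ 2 * length (filter P? xs) ≤ distSum f xs (+ suc j) ℕ.+ length xs
  distSum-suc P⇒0≤f j [] = z≤n
  distSum-suc P⇒0≤f j (x ∷ xs) with P? x
  ... | yes px = ℕ.≤-trans (ℕ.≤-reflexive (cong (distSum f (x ∷ xs) (+ j) ℕ.+_) (ℕ.*-suc 2 _)))
                   (+-mono-≤-interchange {∣ + j ℤ.+ f x ∣} {S = distSum f xs (+ j)}
                      (gain (f x) (P⇒0≤f x px)) (distSum-suc P⇒0≤f j xs))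
    where
    gain : ∀ i → 0ℤ ℤ.≤ i → 2 ℕ.+ ∣ + j ℤ.+ i ∣ ≤ ∣ + suc j ℤ.+ i ∣ ℕ.+ 1
    gain (+ t) _ = ℕ.≤-reflexive (cong suc (ℕ.+-comm 1 (j ℕ.+ t)))
  ... | no _ = +-mono-≤-interchange {∣ + j ℤ.+ f x ∣} {c = 0} {S = distSum f xs (+ j)}
                 (loss (f x)) (distSum-suc P⇒0≤f j xs)
    where
    open ℤ-Solver
    j+i≡1+j+i-1 : ∀ k i → (+ 1 ℤ.+ k) ℤ.+ i ℤ.+ - + 1 ≡ k ℤ.+ i
    j+i≡1+j+i-1 = solve-∀
    loss : ∀ i → ∣ + j ℤ.+ i ∣ ≤ ∣ + suc j ℤ.+ i ∣ ℕ.+ 1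
    loss i = subst (λ t → ∣ t ∣ ≤ ∣ + suc j ℤ.+ i ∣ ℕ.+ 1) (j+i≡1+j+i-1 (+ j) i)
               (ℤ.∣i+j∣≤∣i∣+∣j∣ (+ suc j ℤ.+ i) (- + 1))

  distSum-monotone : (∀ x → P x → 0ℤ ℤ.≤ f x) → ∀ xs → length xs ≤ 2 * length (filter P? xs) →
                     MonotoneOnNonneg (distSum f xs)
  distSum-monotone P⇒0≤f xs half (+≤+ _) (+≤+ a≤b) = mono (ℕ.≤⇒≤′ a≤b)
    where
    distSum-≤-suc : ∀ j → distSum f xs (+ j) ≤ distSum f xs (+ suc j)
    distSum-≤-suc j = ℕ.+-cancelʳ-≤ (length xs) _ _
                        (ℕ.≤-trans (ℕ.+-monoʳ-≤ _ half) (distSum-suc P⇒0≤f j xs))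
    mono : ∀ {a b} → a ≤′ b → distSum f xs (+ a) ≤ distSum f xs (+ b)
    mono ≤′-refl        = ℕ.≤-refl
    mono (≤′-step a≤b) = ℕ.≤-trans (mono a≤b) (distSum-≤-suc _)

distSum-neg : ∀ {A : Set} (f : A → ℤ) xs k → distSum f xs k ≡ distSum (-_ ∘ f) xs (- k)
distSum-neg f xs k = cong sum (List.map-cong
  (λ x → trans (≡.sym (ℤ.∣-i∣≡∣i∣ (k ℤ.+ f x))) (cong ∣_∣ (ℤ.neg-distrib-+ k (f x)))) xs)

distSum-antitone : ∀ {A : Set} (f : A → ℤ) {P : A → Set} (P? : Decidable P) →
                   (∀ x → P x → f x ℤ.≤ 0ℤ) → ∀ xs → length xs ≤ 2 * length (filter P? xs) →
                   AntitoneOnNonpos (distSum f xs)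
distSum-antitone f P? P⇒f≤0 xs half {a} {b} a≤b b≤0 =
  subst₂ _≤_ (≡.sym (distSum-neg f xs b)) (≡.sym (distSum-neg f xs a))
    (distSum-monotone (-_ ∘ f) P? (λ x px → ℤ.neg-mono-≤ (P⇒f≤0 x px)) xs half
      (ℤ.neg-mono-≤ b≤0) (ℤ.neg-mono-≤ a≤b))

-- For r < 6 this is the largest non-positive integer ≡ r (mod 6).
lowerRep : ℕ → ℤ
lowerRep zero    = 0ℤ
lowerRep (suc r) = + suc r ℤ.- + 6

k₂≡lowerRep : ∀ {n} (α β : Colouring n) u → k₂ α β u ≡ lowerRep (twiceDiff (α u) (β u) %ℕ 6)
k₂≡lowerRep α β u with twiceDiff (α u) (β u) %ℕ 6
... | zero  = refl
... | suc r = refl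

module _ {F : ℤ → ℕ} (mono : MonotoneOnNonneg F) (anti : AntitoneOnNonpos F) where

  ⊓-≤-residue : ∀ r q → r ℕ.< 6 → F (+ r) ⊓ F (lowerRep r) ≤ F (+ r ℤ.+ q ℤ.* + 6)
  ⊓-≤-residue r (+ j) _ = ℕ.≤-trans (ℕ.m⊓n≤m _ _) (mono (+≤+ z≤n) r≤r+6j)
    where
    r≤r+6j : + r ℤ.≤ + r ℤ.+ + j ℤ.* + 6
    r≤r+6j = subst (λ t → + r ℤ.≤ + r ℤ.+ t) (ℤ.pos-* j 6) (ℤ.i≤i+j (+ r) (+ (j ℕ.* 6)))
  -- Here -[1+ j ] ℤ.* + 6 computes to -[1+ 5 ℕ.+ j ℕ.* 6 ].
  ⊓-≤-residue zero -[1+ j ] _ = ℕ.≤-trans (ℕ.m⊓n≤n _ _) (anti -≤+ ℤ.≤-refl)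
  ⊓-≤-residue (suc r) -[1+ j ] r<6 =
    ℕ.≤-trans (ℕ.m⊓n≤n _ _) (anti (ℤ.+-monoʳ-≤ (+ suc r) (-≤- (ℕ.m≤m+n 5 (j ℕ.* 6))))
                                  (ℤ.i≤j⇒i-j≤0 (+≤+ (ℕ.<⇒≤ r<6))))

  ⊓-≤-residue-class : ∀ {n} (α β : Colouring n) u x → + 6 ∣ x ℤ.- twiceDiff (α u) (β u) →
                      F (k₁ α β u) ⊓ F (k₂ α β u) ≤ F x
  ⊓-≤-residue-class α β u x (divides m x-y≡m*6) rewrite k₂≡lowerRep α β u =
    subst (λ t → F (+ r) ⊓ F (lowerRep r) ≤ F t) (≡.sym x≡r+q*6)
      (⊓-≤-residue r (y /ℕ 6 ℤ.+ m) (n%ℕd<d y 6))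
    where
    y = twiceDiff (α u) (β u)
    r = y %ℕ 6
    regroup : ∀ x y m r q → x ℤ.- y ≡ m ℤ.* + 6 → y ≡ r ℤ.+ q ℤ.* + 6 → x ≡ r ℤ.+ (q ℤ.+ m) ℤ.* + 6
    regroup x y m r q x-y≡ y≡ = begin
      x                                   ≡⟨ solve (x ∷ y ∷ []) ⟩
      (x ℤ.- y) ℤ.+ y                     ≡⟨ cong₂ ℤ._+_ x-y≡ y≡ ⟩
      m ℤ.* + 6 ℤ.+ (r ℤ.+ q ℤ.* + 6)     ≡⟨ solve (m ∷ r ∷ q ∷ []) ⟩
      r ℤ.+ (q ℤ.+ m) ℤ.* + 6             ∎
      where open ≡-Reasoning; open ℤ-Solver
    x≡r+q*6 : x ≡ + r ℤ.+ (y /ℕ 6 ℤ.+ m) ℤ.* + 6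
    x≡r+q*6 = regroup x y m (+ r) (y /ℕ 6) x-y≡m*6 (a≡a%ℕn+[a/ℕn]*n y 6)

AtMostOneDiff-sym : ∀ {n} {c d : Colouring n} → AtMostOneDiff c d → AtMostOneDiff d c
AtMostOneDiff-sym (v , same) = v , λ x x≢v → ≡.sym (same x x≢v)

reverseFrom : ∀ {n} {G : Graph n} {α β ℓ} (R : Recolouring G α β ℓ) i → i ≤ ℓ →
              Recolouring G β (Recolouring.seq R i) (ℓ ∸ i)
reverseFrom {ℓ = ℓ} R i i≤ℓ = record
  { seq    = λ j → seq (ℓ ∸ j)
  ; start  = end
  ; end    = λ x → cong (λ k → seq k x) (ℕ.m∸[m∸n]≡n i≤ℓ)
  ; proper = λ j _ → proper (ℓ ∸ j) (ℕ.m∸n≤m ℓ j)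
  ; steps  = λ j j<ℓ∸i → stepBack j (ℕ.<-≤-trans j<ℓ∸i (ℕ.m∸n≤m ℓ i))
  }
  where
  open Recolouring R
  stepBack : ∀ j → j ℕ.< ℓ → AtMostOneDiff (seq (ℓ ∸ j)) (seq (ℓ ∸ suc j))
  stepBack j j<ℓ = subst (λ k → AtMostOneDiff (seq k) (seq (ℓ ∸ suc j))) 1+ℓ∸1+j≡ℓ∸j
                     (AtMostOneDiff-sym (steps (ℓ ∸ suc j) ℓ∸1+j<ℓ))
    where
    1+ℓ∸1+j≡ℓ∸j : suc (ℓ ∸ suc j) ≡ ℓ ∸ j
    1+ℓ∸1+j≡ℓ∸j = ≡.sym (ℕ.+-∸-assoc 1 j<ℓ)
    ℓ∸1+j<ℓ : ℓ ∸ suc j ℕ.< ℓ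
    ℓ∸1+j<ℓ = subst (_≤ ℓ) (≡.sym 1+ℓ∸1+j≡ℓ∸j) (ℕ.m∸n≤m ℓ j)

walkWeight-cong : ∀ {n} {_~_ : Fin n → Fin n → Set} {c d : Colouring n} → (∀ x → c x ≡ d x) →
                  ∀ {u v} (p : Walk _~_ u v) → walkWeight c p ≡ walkWeight d p
walkWeight-cong c≗d []                 = refl
walkWeight-cong {c = c} {d} c≗d (step {u} {x} _ p) = cong₂ ℤ._+_
  (trans (w≡w₃ c u x) (trans (cong₂ w₃ (c≗d u) (c≗d x)) (≡.sym (w≡w₃ d u x))))
  (walkWeight-cong c≗d p)

module Displacement {n} {G : Graph n} {α β : Colouring n} {ℓ} (R : Recolouring G α β ℓ) where
  open Recolouring R

  shiftAt : ℕ → Fin n → ℤ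
  shiftAt i v = shift (seq i v) (seq (suc i) v)

  displacement : ℕ → Fin n → ℤ
  displacement zero    v = 0ℤ
  displacement (suc i) v = displacement i v ℤ.+ shiftAt i v

  shiftAt-unchanged : ∀ {i v} → seq i v ≡ seq (suc i) v → shiftAt i v ≡ 0ℤ
  shiftAt-unchanged {i} {v} eq = trans (cong (shift (seq i v)) (≡.sym eq)) (shift-refl (seq i v))

  w-recolour : ∀ {i} → i ℕ.< ℓ → ∀ {x y} → E G x y →
               w (seq (suc i)) x y ℤ.+ shiftAt i x ≡ w (seq i) x y ℤ.+ shiftAt i y
  w-recolour {i} i<ℓ {x} {y} xy rewrite w≡w₃ (seq (suc i)) x y | w≡w₃ (seq i) x y =
    w₃-recolour _ _ _ _ (proper i (ℕ.<⇒≤ i<ℓ) x y xy) (proper (suc i) i<ℓ x y xy)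
                (endpointKept (steps i i<ℓ))
    where
    endpointKept : AtMostOneDiff (seq i) (seq (suc i)) →
                   seq i x ≡ seq (suc i) x ⊎ seq i y ≡ seq (suc i) y
    endpointKept (v , same) with x ≟ᶠ v
    ... | no x≢v   = inj₁ (same x x≢v)
    ... | yes refl = inj₂ (same y λ { refl → irrefl G xy })

  module _ {_~_ : Fin n → Fin n → Set} (~⇒E : ∀ {x y} → x ~ y → E G x y) where

    walkWeight-recolour : ∀ {i} → i ℕ.< ℓ → ∀ {u v} (p : Walk _~_ u v) →
                          walkWeight (seq (suc i)) p ℤ.+ shiftAt i u ≡ walkWeight (seq i) p ℤ.+ shiftAt i v
    walkWeight-recolour i<ℓ [] = refl
    walkWeight-recolour {i} i<ℓ (step {u} {x} {v} ux p) = begin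
      (w′ u x ℤ.+ W′) ℤ.+ shiftAt i u   ≡⟨ ℤ+.xy∙z≈xz∙y (w′ u x) W′ _ ⟩
      (w′ u x ℤ.+ shiftAt i u) ℤ.+ W′   ≡⟨ cong (ℤ._+ W′) (w-recolour i<ℓ (~⇒E ux)) ⟩
      (w″ u x ℤ.+ shiftAt i x) ℤ.+ W′   ≡⟨ ℤ+.xy∙z≈x∙zy (w″ u x) _ W′ ⟩
      w″ u x ℤ.+ (W′ ℤ.+ shiftAt i x)   ≡⟨ cong (λ t → w″ u x ℤ.+ t) (walkWeight-recolour i<ℓ p) ⟩
      w″ u x ℤ.+ (W ℤ.+ shiftAt i v)    ≡⟨ ℤ.+-assoc (w″ u x) W _ ⟨
      (w″ u x ℤ.+ W) ℤ.+ shiftAt i v    ∎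
      where
      open ≡-Reasoning
      w′ = w (seq (suc i))
      w″ = w (seq i)
      W′ = walkWeight (seq (suc i)) p
      W  = walkWeight (seq i) p

    walkWeight-displacement : ∀ {i} → i ≤ ℓ → ∀ {u v} (p : Walk _~_ u v) →
                              walkWeight (seq i) p ℤ.+ displacement i u ≡ walkWeight α p ℤ.+ displacement i v
    walkWeight-displacement {zero} _ p = cong (ℤ._+ 0ℤ) (walkWeight-cong start p)
    walkWeight-displacement {suc i} i<ℓ {u} {v} p = begin
      W′ ℤ.+ (D u ℤ.+ shiftAt i u)   ≡⟨ ℤ+.x∙yz≈xz∙y W′ (D u) _ ⟩
      (W′ ℤ.+ shiftAt i u) ℤ.+ D u   ≡⟨ cong (ℤ._+ D u) (walkWeight-recolour i<ℓ p) ⟩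
      (W ℤ.+ shiftAt i v) ℤ.+ D u    ≡⟨ ℤ+.xy∙z≈xz∙y W _ (D u) ⟩
      (W ℤ.+ D u) ℤ.+ shiftAt i v    ≡⟨ cong (ℤ._+ shiftAt i v) (walkWeight-displacement (ℕ.<⇒≤ i<ℓ) p) ⟩
      (Wα ℤ.+ D v) ℤ.+ shiftAt i v   ≡⟨ ℤ.+-assoc Wα (D v) _ ⟩
      Wα ℤ.+ (D v ℤ.+ shiftAt i v)   ∎
      where
      open ≡-Reasoning
      D  = displacement i
      W′ = walkWeight (seq (suc i)) p
      W  = walkWeight (seq i) p
      Wα = walkWeight α p

  ∑∣displacement∣≤ : ∀ {i} → i ≤ ℓ → ∑ n (λ v → ∣ displacement i v ∣) ≤ 2 * i
  ∑∣displacement∣≤ {zero} _ = ℕ.≤-reflexive (∑-zero n)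
  ∑∣displacement∣≤ {suc i} i<ℓ with steps i i<ℓ
  ... | v , same = begin
    ∑ n (λ x → ∣ displacement (suc i) x ∣)   ≤⟨ ∑-≤-except v unchanged moved ⟩
    ∑ n (λ x → ∣ displacement i x ∣) ℕ.+ 2   ≤⟨ ℕ.+-monoˡ-≤ 2 (∑∣displacement∣≤ (ℕ.<⇒≤ i<ℓ)) ⟩
    2 * i ℕ.+ 2                              ≡⟨ ℕ.+-comm (2 * i) 2 ⟩
    2 ℕ.+ 2 * i                              ≡⟨ ℕ.*-suc 2 i ⟨
    2 * suc i                                ∎
    where
    open ℕ.≤-Reasoning
    unchanged : ∀ x → x ≢ v → ∣ displacement (suc i) x ∣ ≤ ∣ displacement i x ∣
    unchanged x x≢v = ℕ.≤-reflexive (cong ∣_∣ (trans (cong (λ t → displacement i x ℤ.+ t)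
      (shiftAt-unchanged (same x x≢v))) (ℤ.+-identityʳ (displacement i x))))
    moved : ∣ displacement (suc i) v ∣ ≤ ∣ displacement i v ∣ ℕ.+ 2
    moved = ℕ.≤-trans (ℤ.∣i+j∣≤∣i∣+∣j∣ (displacement i v) _)
                      (ℕ.+-monoʳ-≤ _ (∣shift∣≤2 (seq i v) (seq (suc i) v)))

  displacement≡twiceDiff-mod-6 : ∀ {i} → i ≤ ℓ → ∀ v →
                                 + 6 ∣ displacement i v ℤ.- twiceDiff (α v) (seq i v)
  displacement≡twiceDiff-mod-6 {zero} _ v =
    subst (λ c → + 6 ∣ 0ℤ ℤ.- twiceDiff (α v) c) (≡.sym (start v))
      (subst (λ t → + 6 ∣ 0ℤ ℤ.- t) (≡.sym (twiceDiff-refl (α v))) (divides 0ℤ refl))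
  displacement≡twiceDiff-mod-6 {suc i} i<ℓ v =
    ∣-twiceDiff-trans {displacement i v} {shiftAt i v} (α v) (seq i v) (seq (suc i) v)
      (displacement≡twiceDiff-mod-6 (ℕ.<⇒≤ i<ℓ) v) (shift≡twiceDiff-mod-6 (seq i v) (seq (suc i) v))

  displacement-unchanged : ∀ {v} → (∀ i → i ℕ.< ℓ → seq i v ≡ seq (suc i) v) →
                           ∀ {i} → i ≤ ℓ → displacement i v ≡ 0ℤ
  displacement-unchanged _ {zero} _ = refl
  displacement-unchanged kept {suc i} i<ℓ =
    cong₂ ℤ._+_ (displacement-unchanged kept (ℕ.<⇒≤ i<ℓ)) (shiftAt-unchanged (kept i i<ℓ))

  module _ (T : SpanningTree G) where

    h≡displacement-difference : ∀ u v → h T α u β v ≡ displacement ℓ v ℤ.- displacement ℓ u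
    h≡displacement-difference u v = begin
      Wβ ℤ.- Wα                             ≡⟨ cancel Wβ Wα Du ⟩
      (Wβ ℤ.+ Du) ℤ.- (Wα ℤ.+ Du)           ≡⟨ cong (λ t → (t ℤ.+ Du) ℤ.- (Wα ℤ.+ Du))
                                                   (walkWeight-cong (λ x → ≡.sym (end x)) p) ⟩
      (Wℓ ℤ.+ Du) ℤ.- (Wα ℤ.+ Du)           ≡⟨ cong (ℤ._- (Wα ℤ.+ Du))
                                                   (walkWeight-displacement (TE-sub T) ℕ.≤-refl p) ⟩
      (Wα ℤ.+ Dv) ℤ.- (Wα ℤ.+ Du)           ≡⟨ cancel′ Wα Dv Du ⟩
      Dv ℤ.- Du                             ∎
      where
      open ≡-Reasoning
      open ℤ-Solver
      p  = P T u v
      Wβ = walkWeight β p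
      Wα = walkWeight α p
      Wℓ = walkWeight (seq ℓ) p
      Du = displacement ℓ u
      Dv = displacement ℓ v
      cancel : ∀ a b c → a ℤ.- b ≡ (a ℤ.+ c) ℤ.- (b ℤ.+ c)
      cancel = solve-∀
      cancel′ : ∀ a b c → (a ℤ.+ b) ℤ.- (a ℤ.+ c) ≡ b ℤ.- c
      cancel′ = solve-∀

    h-rebase : ∀ u u* v → h T α u β v ℤ.- h T α u β u* ≡ h T α u* β v
    h-rebase u u* v = begin
      h T α u β v ℤ.- h T α u β u*     ≡⟨ cong₂ ℤ._-_ (h≡displacement-difference u v)
                                                      (h≡displacement-difference u u*) ⟩
      (D v ℤ.- D u) ℤ.- (D u* ℤ.- D u) ≡⟨ rebase (D v) (D u) (D u*) ⟩
      D v ℤ.- D u*                     ≡⟨ h≡displacement-difference u* v ⟨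
      h T α u* β v                     ∎
      where
      open ≡-Reasoning
      open ℤ-Solver
      D = displacement ℓ
      rebase : ∀ a b c → (a ℤ.- b) ℤ.- (c ℤ.- b) ≡ a ℤ.- c
      rebase = solve-∀

    J-displacement : ∀ u* → J T α β u* (displacement ℓ u*) ≤ 2 * ℓ
    J-displacement u* = begin
      J T α β u* (D u*)           ≡⟨ cong sum (List.map-cong J-term (allFin n)) ⟩
      ∑ n (λ v → ∣ D v ∣)         ≤⟨ ∑∣displacement∣≤ ℕ.≤-refl ⟩
      2 * ℓ                       ∎
      where
      open ℕ.≤-Reasoning
      open ℤ-Solver
      D = displacement ℓ
      a+[b-a]≡b : ∀ a b → a ℤ.+ (b ℤ.- a) ≡ b
      a+[b-a]≡b = solve-∀
      J-term : ∀ v → ∣ D u* ℤ.+ h T α u* β v ∣ ≡ ∣ D v ∣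
      J-term v = cong ∣_∣ (trans (cong (λ t → D u* ℤ.+ t) (h≡displacement-difference u* v))
                                 (a+[b-a]≡b (D u*) (D v)))

    module _ (u* u : Fin n) where

      J-monotone : n ≤ 2 * countGeq T α u β (h T α u β u*) → MonotoneOnNonneg (J T α β u*)
      J-monotone half = distSum-monotone (h T α u* β) (λ v → h T α u β u* ℤ.≤? h T α u β v)
        (λ v above → subst (0ℤ ℤ.≤_) (h-rebase u u* v) (ℤ.i≤j⇒0≤j-i above))
        (allFin n) (ℕ.≤-trans (ℕ.≤-reflexive (List.length-tabulate (λ x → x))) half)

      J-antitone : n ≤ 2 * countLeq T α u β (h T α u β u*) → AntitoneOnNonpos (J T α β u*)
      J-antitone half = distSum-antitone (h T α u* β) (λ v → h T α u β v ℤ.≤? h T α u β u*)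
        (λ v below → subst (ℤ._≤ 0ℤ) (h-rebase u u* v) (ℤ.i≤j⇒i-j≤0 below))
        (allFin n) (ℕ.≤-trans (ℕ.≤-reflexive (List.length-tabulate (λ x → x))) half)

Fixed⇒colour-constant : ∀ {n} {G : Graph n} {α β ℓ} (R : Recolouring G α β ℓ) {v} → Fixed G β v →
                        ∀ i → i ≤ ℓ → Recolouring.seq R i v ≡ β v
Fixed⇒colour-constant {ℓ = ℓ} R fixed i i≤ℓ =
  fixed (seq i) (proper i i≤ℓ) (ℓ ∸ i , reverseFrom R i i≤ℓ)
  where open Recolouring R

k₁-refl : ∀ {n} (α β : Colouring n) u → α u ≡ β u → k₁ α β u ≡ 0ℤ
k₁-refl α β u αu≡βu = trans (cong (λ c → + (twiceDiff (α u) c %ℕ 6)) (≡.sym αu≡βu))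
                            (cong (λ t → + (t %ℕ 6)) (twiceDiff-refl (α u)))

lemma11 : {n : ℕ} (G : Graph n) → Connected G → (T : SpanningTree G) →
          (α β : Colouring n) → Proper G α → Proper G β →
          (u* : Fin n) → Focal T α β u* →
          (ℓ : ℕ) → Recolouring G α β ℓ →
          J T α β u* (k₁ α β u*) ⊓ J T α β u* (k₂ α β u*) ≤ 2 * ℓ
lemma11 G _ T α β _ _ u* (inj₁ fixed) ℓ R = begin
  J T α β u* (k₁ α β u*) ⊓ J T α β u* (k₂ α β u*) ≤⟨ ℕ.m⊓n≤m _ _ ⟩
  J T α β u* (k₁ α β u*)                          ≡⟨ cong (J T α β u*) k₁≡D ⟩
  J T α β u* (displacement ℓ u*)                  ≤⟨ J-displacement T u* ⟩
  2 * ℓ                                           ∎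
  where
  open ℕ.≤-Reasoning hiding (start)
  open Recolouring R
  open Displacement R
  constant : ∀ i → i ≤ ℓ → seq i u* ≡ β u*
  constant = Fixed⇒colour-constant R fixed
  αu*≡βu* : α u* ≡ β u*
  αu*≡βu* = trans (≡.sym (start u*)) (constant 0 z≤n)
  D≡0 : displacement ℓ u* ≡ 0ℤ
  D≡0 = displacement-unchanged
          (λ i i<ℓ → trans (constant i (ℕ.<⇒≤ i<ℓ)) (≡.sym (constant (suc i) i<ℓ))) ℕ.≤-refl
  k₁≡D : k₁ α β u* ≡ displacement ℓ u*
  k₁≡D = trans (k₁-refl α β u* αu*≡βu*) (≡.sym D≡0)
lemma11 G _ T α β _ _ u* (inj₂ (_ , u , below , above)) ℓ R = begin
  J T α β u* (k₁ α β u*) ⊓ J T α β u* (k₂ α β u*) ≤⟨ ⊓-≤-residue-class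
                                                       (J-monotone T u* u above) (J-antitone T u* u below)
                                                       α β u* (displacement ℓ u*) residue ⟩
  J T α β u* (displacement ℓ u*)                  ≤⟨ J-displacement T u* ⟩
  2 * ℓ                                           ∎
  where
  open ℕ.≤-Reasoning
  open Recolouring R
  open Displacement R
  residue : + 6 ∣ displacement ℓ u* ℤ.- twiceDiff (α u*) (β u*)
  residue = subst (λ c → + 6 ∣ displacement ℓ u* ℤ.- twiceDiff (α u*) c) (end u*)
                  (displacement≡twiceDiff-mod-6 ℕ.≤-refl u*)
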